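{- Let $G$ be a graph containing at least two (distinct) cycles and let $F$ be a forest with the same number of vertices as $G$. Then $G$ and $F$ have at most two common cards.
   Context: All graphs are finite and simple. For a graph $X$ and a vertex $v$, the card $X-v$ is the unlabeled graph obtained by deleting $v$ and its incident edges; the deck of $X$ is the multiset $\{X-v : v\in V(X)\}$. The number of common cards of two graphs $X,Y$ on the same number of vertices is the size of the multiset intersection of their decks, i.e. the largest $m$ such that there are distinct vertices $x_1,\dots,x_m$ of $X$ and distinct vertices $y_1,\dots,y_m$ of $Y$ with $X-x_i\cong Y-y_i$ for all $i$. -}

module Defs where

open import Data.Nat using (ℕ; zero; suc)
open import Data.Bool using (Bool; true; false)
open import Data.Fin using (Fin; zero; suc; inject₁; fromℕ; punchIn)
open import Data.Fin.Permutation using (Permutation′; _⟨$⟩ʳ_)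
open import Data.Product using (Σ; _×_; ∃; _,_)
open import Data.Sum using (_⊎_)
open import Data.Empty using (⊥)
open import Function.Definitions using (Injective)
open import Relation.Nullary using (¬_)
open import Relation.Binary.PropositionalEquality using (_≡_)

record Graph (n : ℕ) : Set where
  field
    adj   : Fin n → Fin n → Bool
    sym   : ∀ i j → adj i j ≡ adj j i
    irrefl : ∀ i → adj i i ≡ false
open Graph public

_≅_ : ∀ {n} → Graph n → Graph n → Set
_≅_ {n} X Y = Σ (Permutation′ n) λ σ →
  ∀ i j → adj X i j ≡ adj Y (σ ⟨$⟩ʳ i) (σ ⟨$⟩ʳ j)

card : ∀ {n} → Graph (suc n) → Fin (suc n) → Graph n
card X v = record
  { adj    = λ i j → adj X (punchIn v i) (punchIn v j)
  ; sym    = λ i j → sym X (punchIn v i) (punchIn v j)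
  ; irrefl = λ i → irrefl X (punchIn v i)
  }

HasCommonCards : ∀ {n} → ℕ → Graph (suc n) → Graph (suc n) → Set
HasCommonCards {n} m X Y =
  Σ (Fin m → Fin (suc n)) λ x → Σ (Fin m → Fin (suc n)) λ y →
    Injective _≡_ _≡_ x × Injective _≡_ _≡_ y × (∀ i → card X (x i) ≅ card Y (y i))

-- A cycle of length k+3 in X: an injective cyclic sequence of vertices
-- c 0, c 1, …, c (k+2) with consecutive vertices (cyclically) adjacent.
record Cycle {n} (X : Graph n) : Set where
  field
    len-3 : ℕ
    vtx   : Fin (suc (suc (suc len-3))) → Fin n
    inj   : Injective _≡_ _≡_ vtx
    step  : ∀ (i : Fin (suc (suc len-3))) → adj X (vtx (inject₁ i)) (vtx (suc i)) ≡ true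
    close : adj X (vtx (fromℕ (suc (suc len-3)))) (vtx zero) ≡ true
open Cycle public

SameEdge : ∀ {n} → Fin n → Fin n → Fin n → Fin n → Set
SameEdge a b u w = (a ≡ u × b ≡ w) ⊎ (a ≡ w × b ≡ u)

EdgeOf : ∀ {n} {X : Graph n} → Cycle X → Fin n → Fin n → Set
EdgeOf C u w =
  (∃ λ i → SameEdge (vtx C (inject₁ i)) (vtx C (suc i)) u w)
  ⊎ SameEdge (vtx C (fromℕ (suc (suc (len-3 C))))) (vtx C zero) u w

-- Two cycles are the same cycle (subgraph) iff they have the same edge set.
SameCycle : ∀ {n} {X : Graph n} → Cycle X → Cycle X → Set
SameCycle C D = ∀ u w → (EdgeOf C u w → EdgeOf D u w) × (EdgeOf D u w → EdgeOf C u w)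

HasTwoCycles : ∀ {n} → Graph n → Set
HasTwoCycles X = Σ (Cycle X) λ C → Σ (Cycle X) λ D → ¬ SameCycle C D

IsForest : ∀ {n} → Graph n → Set
IsForest X = ¬ Cycle X

module Submission where

-- If card G − x is isomorphic to a card of a forest, then G − x has no cycle, so x lies on
-- every cycle of G; three common cards would give three distinct such vertices.  But if G
-- has two distinct cycles C ≠ D, some edge of D is not an edge of C, and following D from
-- that edge yields an ear of C: a path that leaves C at a vertex s, avoids C, and first
-- returns at a vertex t ≠ s.  C and the ear form a theta graph whose three cycles (C, and
-- the ear closed up along either arc of C from s to t) have only s and t in common.

open import Defs
open import Data.Bool using (true)
open import Data.Empty using (⊥; ⊥-elim)
open import Data.Fin as Fin using (Fin; zero; suc; toℕ; inject₁; fromℕ; fromℕ<; punchIn; punchOut)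
open import Data.Fin.Permutation using (_⟨$⟩ʳ_; _⟨$⟩ˡ_; inverseˡ)
open import Data.Fin.Properties
  using (any?; toℕ-injective; toℕ-inject₁; toℕ-fromℕ; toℕ-fromℕ<; toℕ<n; fromℕ<-cong;
         punchIn-punchOut; punchOut-injective; punchIn-injective)
open import Data.Nat using (ℕ; zero; suc; _+_; _*_; _∸_; _≤_; _<_; _≤?_; z≤n; s≤s; NonZero; >-nonZero)
open import Data.Nat.DivMod
  using (_%_; _/_; _mod_; m≡m%n+[m/n]*n; m%n<n; m<n⇒m%n≡m; m%n%n≡m%n; [m+n]%n≡m%n; [m+kn]%n≡m%n)
open import Data.Nat.Divisibility using (_∣_; divides; ∣⇒≤)
open import Data.Nat.Properties
open import Data.Product as Product using (_×_; ∃; _,_; proj₁; proj₂)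
open import Data.Sum as Sum using (_⊎_; inj₁; inj₂)
open import Function using (_∘′_)
open import Relation.Binary.Definitions using (tri<; tri≈; tri>)
open import Relation.Binary.PropositionalEquality
  using (_≡_; _≢_; refl; trans; cong; cong₂; subst; subst₂; module ≡-Reasoning)
  renaming (sym to ≡-sym)
open import Relation.Nullary using (¬_; Dec; yes; no)
open import Relation.Nullary.Decidable using (_×-dec_; _⊎-dec_; ¬?)

%≡%⇒∣∸ : ∀ a b L .{{_ : NonZero L}} → a % L ≡ b % L → L ∣ b ∸ a
%≡%⇒∣∸ a b L eq = divides (b / L ∸ a / L) (begin
  b ∸ a                                      ≡⟨ cong₂ _∸_ (m≡m%n+[m/n]*n b L) (m≡m%n+[m/n]*n a L) ⟩
  (b % L + b / L * L) ∸ (a % L + a / L * L)  ≡⟨ cong (λ r → (r + b / L * L) ∸ (a % L + a / L * L)) (≡-sym eq) ⟩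
  (a % L + b / L * L) ∸ (a % L + a / L * L)  ≡⟨ [m+n]∸[m+o]≡n∸o (a % L) _ _ ⟩
  b / L * L ∸ a / L * L                      ≡⟨ ≡-sym (*-distribʳ-∸ L (b / L) (a / L)) ⟩
  (b / L ∸ a / L) * L                        ∎)
  where open ≡-Reasoning

m<n<m+o⇒m%o≢n%o : ∀ {m n} o .{{_ : NonZero o}} → m < n → n < m + o → m % o ≢ n % o
m<n<m+o⇒m%o≢n%o {m} {n} o m<n n<m+o eq =
  <⇒≱ (m<n+o⇒m∸n<o n m n<m+o) (∣⇒≤ {{>-nonZero (m<n⇒0<n∸m m<n)}} (%≡%⇒∣∸ m n o eq))

≤-or-beyond : ∀ k a → a ≤ k ⊎ ∃ λ i → a ≡ k + suc i
≤-or-beyond zero    zero    = inj₁ z≤n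
≤-or-beyond zero    (suc a) = inj₂ (a , refl)
≤-or-beyond (suc k) zero    = inj₁ z≤n
≤-or-beyond (suc k) (suc a) with ≤-or-beyond k a
... | inj₁ a≤k        = inj₁ (s≤s a≤k)
... | inj₂ (i , refl) = inj₂ (i , refl)

m+n<2⇒m≡1∧n≡0 : ∀ {m n} → 0 < m → m + n < 2 → m ≡ 1 × n ≡ 0
m+n<2⇒m≡1∧n≡0 {suc zero}    {zero}  _ _              = refl , refl
m+n<2⇒m≡1∧n≡0 {suc zero}    {suc _} _ (s≤s (s≤s ()))
m+n<2⇒m≡1∧n≡0 {suc (suc _)}         _ (s≤s (s≤s ()))

pair-pigeonhole : ∀ {A : Set} {a b x y z : A} → x ≢ y → x ≢ z → y ≢ z →
                  x ≡ a ⊎ x ≡ b → y ≡ a ⊎ y ≡ b → z ≡ a ⊎ z ≡ b → ⊥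
pair-pigeonhole x≢y _   _   (inj₁ refl) (inj₁ refl) _           = x≢y refl
pair-pigeonhole x≢y _   _   (inj₂ refl) (inj₂ refl) _           = x≢y refl
pair-pigeonhole _   x≢z _   (inj₁ refl) (inj₂ refl) (inj₁ refl) = x≢z refl
pair-pigeonhole _   _   y≢z (inj₁ refl) (inj₂ refl) (inj₂ refl) = y≢z refl
pair-pigeonhole _   _   y≢z (inj₂ refl) (inj₁ refl) (inj₁ refl) = y≢z refl
pair-pigeonhole _   x≢z _   (inj₂ refl) (inj₁ refl) (inj₂ refl) = x≢z refl

module _ {P : ℕ → Set} (P? : ∀ i → Dec (P i)) where

  least : ∀ {n} → P n → ∃ λ k → k ≤ n × P k × (∀ {i} → i < k → ¬ P i)
  least {n} pn with below (suc n)
    where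
    below : ∀ n → (∀ {i} → i < n → ¬ P i) ⊎ (∃ λ k → k < n × P k × (∀ {i} → i < k → ¬ P i))
    below zero = inj₁ λ ()
    below (suc n) with below n
    ... | inj₂ (k , k<n , pk , min) = inj₂ (k , m<n⇒m<1+n k<n , pk , min)
    ... | inj₁ none with P? n
    ...   | yes pn = inj₂ (n , ≤-refl , pn , none)
    ...   | no ¬pn = inj₁ λ i<1+n → Sum.[ none , (λ { refl → ¬pn }) ] (m<1+n⇒m<n∨m≡n i<1+n)
  ... | inj₁ none                   = ⊥-elim (none ≤-refl pn)
  ... | inj₂ (k , k<1+n , pk , min) = k , ≤-pred k<1+n , pk , min

  greatest : ∀ n {z} → z ≤ n → P z → ∃ λ j → j ≤ n × P j × (∀ {i} → j < i → i ≤ n → ¬ P i)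
  greatest n z≤ pz with P? n
  ... | yes pn = n , ≤-refl , pn , λ n<i i≤n _ → <⇒≱ n<i i≤n
  greatest zero    z≤n pz | no ¬pn = ⊥-elim (¬pn pz)
  greatest (suc n) z≤  pz | no ¬pn with m≤n⇒m<n∨m≡n z≤
  ... | inj₂ refl = ⊥-elim (¬pn pz)
  ... | inj₁ z<1+n with greatest n (≤-pred z<1+n) pz
  ...   | j , j≤n , pj , max = j , m≤n⇒m≤1+n j≤n , pj ,
          λ j<i i≤1+n → Sum.[ max j<i ∘′ ≤-pred , (λ { refl → ¬pn }) ] (m≤n⇒m<n∨m≡n i≤1+n)

module _ {n} (X : Graph (suc n)) (x : Fin (suc n)) where

  cycle-in-card : (C : Cycle X) → (∀ j → vtx C j ≢ x) → Cycle (card X x)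
  cycle-in-card C avoids = record
    { len-3 = len-3 C
    ; vtx   = λ j → punchOut (x≢ j)
    ; inj   = λ eq → inj C (punchOut-injective (x≢ _) (x≢ _) eq)
    ; step  = λ i → subst₂ adjacent (≡-sym (punchIn-punchOut _)) (≡-sym (punchIn-punchOut _)) (step C i)
    ; close = subst₂ adjacent (≡-sym (punchIn-punchOut _)) (≡-sym (punchIn-punchOut _)) (close C)
    }
    where
    adjacent : Fin (suc n) → Fin (suc n) → Set
    adjacent u w = adj X u w ≡ true
    x≢ : ∀ j → x ≢ vtx C j
    x≢ j = avoids j ∘′ ≡-sym

  cycle-from-card : Cycle (card X x) → Cycle X
  cycle-from-card C = record
    { len-3 = len-3 C
    ; vtx   = punchIn x ∘′ vtx C
    ; inj   = inj C ∘′ punchIn-injective x _ _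
    ; step  = step C
    ; close = close C
    }

cycle-≅ : ∀ {n} {X Y : Graph n} → X ≅ Y → Cycle X → Cycle Y
cycle-≅ (σ , preserves) C = record
  { len-3 = len-3 C
  ; vtx   = λ j → σ ⟨$⟩ʳ vtx C j
  ; inj   = λ eq → inj C (trans (≡-sym (inverseˡ σ)) (trans (cong (σ ⟨$⟩ˡ_) eq) (inverseˡ σ)))
  ; step  = λ i → trans (≡-sym (preserves _ _)) (step C i)
  ; close = trans (≡-sym (preserves _ _)) (close C)
  }

module Walks {n : ℕ} (G : Graph n) where

  V : Set
  V = Fin n

  infix 4 _~_
  _~_ : V → V → Set
  u ~ w = adj G u w ≡ true

  ~-sym : ∀ {u w} → u ~ w → w ~ u
  ~-sym {u} {w} u~w = trans (sym G w u) u~w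

  OnCycle : Cycle G → V → Set
  OnCycle C x = ∃ λ j → vtx C j ≡ x

  OnAllCycles : V → Set
  OnAllCycles x = ∀ C → OnCycle C x

  onCycle? : ∀ C x → Dec (OnCycle C x)
  onCycle? C x = any? (λ j → vtx C j Fin.≟ x)

  size : Cycle G → ℕ
  size C = suc (suc (suc (len-3 C)))

  around : (C : Cycle G) → ℕ → V
  around C a = vtx C (a mod size C)

  module _ (C : Cycle G) where

    private
      L = size C
      last = fromℕ (suc (suc (len-3 C)))

    around-cong : ∀ a b → a % L ≡ b % L → around C a ≡ around C b
    around-cong a b eq = cong (vtx C) (fromℕ<-cong _ _ eq (m%n<n a L) (m%n<n b L))

    around-mod : ∀ a → around C (a % L) ≡ around C a
    around-mod a = around-cong (a % L) a (m%n%n≡m%n a L)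

    around-periodic : ∀ a → around C (a + L) ≡ around C a
    around-periodic a = around-cong (a + L) a ([m+n]%n≡m%n a L)

    around-suc-mod : ∀ a → around C (suc (a % L)) ≡ around C (suc a)
    around-suc-mod a = around-cong (suc (a % L)) (suc a) (begin
      suc (a % L) % L              ≡⟨ ≡-sym ([m+kn]%n≡m%n (suc (a % L)) (a / L) L) ⟩
      suc (a % L + a / L * L) % L  ≡⟨ cong (λ b → suc b % L) (≡-sym (m≡m%n+[m/n]*n a L)) ⟩
      suc a % L                    ∎)
      where open ≡-Reasoning

    around-toℕ : ∀ j → around C (toℕ j) ≡ vtx C j
    around-toℕ j = cong (vtx C) (toℕ-injective (trans (toℕ-fromℕ< _) (m<n⇒m%n≡m (toℕ<n j))))

    around-injective : ∀ {a b} → a < b → b < a + L → around C a ≢ around C b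
    around-injective {a} {b} a<b b<a+L eq = m<n<m+o⇒m%o≢n%o L a<b b<a+L
      (trans (≡-sym (toℕ-fromℕ< _)) (trans (cong toℕ (inj C eq)) (toℕ-fromℕ< _)))

    around-onCycle : ∀ a → OnCycle C (around C a)
    around-onCycle a = a mod L , refl

    around-consecutive : ∀ a →
      (∃ λ i → vtx C (inject₁ i) ≡ around C a × vtx C (suc i) ≡ around C (suc a)) ⊎
      (vtx C last ≡ around C a × vtx C zero ≡ around C (suc a))
    around-consecutive a with m≤n⇒m<n∨m≡n (≤-pred (m%n<n a L))
    ... | inj₁ r<last = inj₁ (i , here , next)
      where
      i = fromℕ< r<last
      here : vtx C (inject₁ i) ≡ around C a
      here = trans (≡-sym (around-toℕ (inject₁ i)))
               (trans (cong (around C) (trans (toℕ-inject₁ i) (toℕ-fromℕ< r<last))) (around-mod a))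
      next : vtx C (suc i) ≡ around C (suc a)
      next = trans (≡-sym (around-toℕ (suc i)))
               (trans (cong (around C ∘′ suc) (toℕ-fromℕ< r<last)) (around-suc-mod a))
    ... | inj₂ r≡last = inj₂ (here , next)
      where
      here : vtx C last ≡ around C a
      here = trans (≡-sym (around-toℕ last))
               (trans (cong (around C) (trans (toℕ-fromℕ _) (≡-sym r≡last))) (around-mod a))
      next : vtx C zero ≡ around C (suc a)
      next = trans (≡-sym (around-periodic 0))
               (trans (cong (around C ∘′ suc) (≡-sym r≡last)) (around-suc-mod a))

    around-step : ∀ a → around C a ~ around C (suc a)
    around-step a with around-consecutive a
    ... | inj₁ (i , here , next) = subst₂ _~_ here next (step C i)
    ... | inj₂ (here , next)     = subst₂ _~_ here next (close C)

    consecutive⇒edgeOf : ∀ a → EdgeOf C (around C a) (around C (suc a))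
    consecutive⇒edgeOf a with around-consecutive a
    ... | inj₁ (i , here , next) = inj₁ (i , inj₁ (here , next))
    ... | inj₂ (here , next)     = inj₂ (inj₁ (here , next))

    edgeOf⇒consecutive : ∀ {u w} → EdgeOf C u w → ∃ λ a → SameEdge (around C a) (around C (suc a)) u w
    edgeOf⇒consecutive {u} {w} (inj₁ (i , e)) =
      toℕ i , subst₂ (λ a b → SameEdge a b u w) here (≡-sym (around-toℕ (suc i))) e
      where
      here : vtx C (inject₁ i) ≡ around C (toℕ i)
      here = trans (≡-sym (around-toℕ (inject₁ i))) (cong (around C) (toℕ-inject₁ i))
    edgeOf⇒consecutive {u} {w} (inj₂ e) =
      toℕ last , subst₂ (λ a b → SameEdge a b u w) (≡-sym (around-toℕ last)) next e
      where
      next : vtx C zero ≡ around C (suc (toℕ last))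
      next = trans (≡-sym (around-periodic 0))
               (cong (around C ∘′ suc) (≡-sym (toℕ-fromℕ (suc (suc (len-3 C))))))

    around-window : ∀ p b → ∃ λ q → q < L × around C (p + q) ≡ around C b
    around-window zero    b = b % L , m%n<n b L , around-mod b
    around-window (suc p) b with around-window p b
    ... | suc q , q<L , e = q , <⇒≤ q<L , trans (cong (around C) (≡-sym (+-suc p q))) e
    ... | zero  , _   , e = suc (suc (len-3 C)) , ≤-refl , (begin
      around C (suc p + suc (suc (len-3 C)))  ≡⟨ cong (around C) (≡-sym (+-suc p _)) ⟩
      around C (p + L)                        ≡⟨ around-periodic p ⟩
      around C p                              ≡⟨ cong (around C) (≡-sym (+-identityʳ p)) ⟩
      around C (p + 0)                        ≡⟨ e ⟩
      around C b                              ∎)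
      where open ≡-Reasoning

    onCycle-window : ∀ p {x} → OnCycle C x → ∃ λ q → q < L × around C (p + q) ≡ x
    onCycle-window p (j , refl) with around-window p (toℕ j)
    ... | q , q<L , e = q , q<L , trans e (around-toℕ j)

  EdgeOf-sym : ∀ (C : Cycle G) {u w} → EdgeOf C u w → EdgeOf C w u
  EdgeOf-sym C = Sum.map (Product.map₂ Sum.swap) Sum.swap

  EdgeOf-resp : ∀ (C : Cycle G) {a b u w} → SameEdge a b u w → EdgeOf C a b → EdgeOf C u w
  EdgeOf-resp C (inj₁ (refl , refl)) e = e
  EdgeOf-resp C (inj₂ (refl , refl)) e = EdgeOf-sym C e

  EdgeOf⇒OnCycle : ∀ (C : Cycle G) {u w} → EdgeOf C u w → OnCycle C w
  EdgeOf⇒OnCycle C (inj₁ (i , inj₁ (_ , e))) = suc i , e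
  EdgeOf⇒OnCycle C (inj₁ (i , inj₂ (e , _))) = inject₁ i , e
  EdgeOf⇒OnCycle C (inj₂ (inj₁ (_ , e)))     = zero , e
  EdgeOf⇒OnCycle C (inj₂ (inj₂ (e , _)))     = fromℕ _ , e

  edgeOf? : ∀ (C : Cycle G) u w → Dec (EdgeOf C u w)
  edgeOf? C u w = any? (λ i → sameEdge? (vtx C (inject₁ i)) (vtx C (suc i)))
                  ⊎-dec sameEdge? (vtx C (fromℕ _)) (vtx C zero)
    where
    sameEdge? : ∀ a b → Dec (SameEdge a b u w)
    sameEdge? a b = (a Fin.≟ u ×-dec b Fin.≟ w) ⊎-dec (a Fin.≟ w ×-dec b Fin.≟ u)

  record Path (k : ℕ) : Set where
    field
      at           : ℕ → V
      at-injective : ∀ {a b} → a ≤ k → b ≤ k → at a ≡ at b → a ≡ b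
      at-step      : ∀ {a} → a < k → at a ~ at (suc a)
  open Path public

  reverse : ∀ {k} → Path k → Path k
  reverse {k} P = record
    { at           = λ a → at P (k ∸ a)
    ; at-injective = λ {a} {b} a≤k b≤k eq → ∸-cancelˡ-≡ a≤k b≤k (at-injective P (m∸n≤m k a) (m∸n≤m k b) eq)
    ; at-step      = λ {a} a<k → subst (λ b → at P b ~ at P (k ∸ suc a)) (≡-sym (+-∸-assoc 1 a<k))
                                   (~-sym (at-step P (∸-monoʳ-< (s≤s z≤n) a<k)))
    }

  init : ∀ {k} → Path (suc k) → Path k
  init P = record
    { at           = at P
    ; at-injective = λ a≤k b≤k → at-injective P (m≤n⇒m≤1+n a≤k) (m≤n⇒m≤1+n b≤k)
    ; at-step      = λ a<k → at-step P (m<n⇒m<1+n a<k)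
    }

  arc : (C : Cycle G) (p k : ℕ) → k < size C → Path k
  arc C p k k<L = record
    { at           = λ a → around C (p + a)
    ; at-injective = injective
    ; at-step      = λ {a} _ → subst (λ b → around C (p + a) ~ around C b) (≡-sym (+-suc p a)) (around-step C (p + a))
    }
    where
    within : ∀ {a b} → b ≤ k → p + b < p + a + size C
    within {a} {b} b≤k = subst (p + b <_) (≡-sym (+-assoc p a (size C)))
      (+-monoʳ-< p (≤-<-trans b≤k (<-≤-trans k<L (m≤n+m (size C) a))))
    injective : ∀ {a b} → a ≤ k → b ≤ k → around C (p + a) ≡ around C (p + b) → a ≡ b
    injective {a} {b} a≤k b≤k eq with <-cmp a b
    ... | tri< a<b _ _ = ⊥-elim (around-injective C (+-monoʳ-< p a<b) (within b≤k) eq)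
    ... | tri≈ _ a≡b _ = a≡b
    ... | tri> _ _ b<a = ⊥-elim (around-injective C (+-monoʳ-< p b<a) (within a≤k) (≡-sym eq))

  module Join {k j} (P : Path k) (Q : Path j) (meet : at P k ≡ at Q 0) where

    concat : ℕ → V
    concat a with a ≤? k
    ... | yes _ = at P a
    ... | no _  = at Q (a ∸ k)

    concat-≤ : ∀ {a} → a ≤ k → concat a ≡ at P a
    concat-≤ {a} a≤k with a ≤? k
    ... | yes _  = refl
    ... | no a≰k = ⊥-elim (a≰k a≤k)

    concat-+ : ∀ i → concat (k + i) ≡ at Q i
    concat-+ zero = trans (concat-≤ (≤-reflexive (+-identityʳ k))) (trans (cong (at P) (+-identityʳ k)) meet)
    concat-+ (suc i) with k + suc i ≤? k
    ... | yes k+1+i≤k = ⊥-elim (m+1+n≰m k k+1+i≤k)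
    ... | no _        = cong (at Q) (m+n∸m≡n k (suc i))

    concat-on : ∀ {a} → a ≤ k + j →
                (∃ λ b → b ≤ k × at P b ≡ concat a) ⊎ (∃ λ i → 0 < i × i ≤ j × at Q i ≡ concat a)
    concat-on {a} a≤ with ≤-or-beyond k a
    ... | inj₁ a≤k        = inj₁ (a , a≤k , ≡-sym (concat-≤ a≤k))
    ... | inj₂ (i , refl) = inj₂ (suc i , s≤s z≤n , +-cancelˡ-≤ k _ _ a≤ , ≡-sym (concat-+ (suc i)))

    module _ (disjoint : ∀ {a i} → a ≤ k → 0 < i → i ≤ j → at P a ≢ at Q i) where

      private
        injective : ∀ {a b} → a ≤ k + j → b ≤ k + j → concat a ≡ concat b → a ≡ b
        injective {a} {b} a≤ b≤ eq with ≤-or-beyond k a | ≤-or-beyond k b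
        ... | inj₁ a≤k | inj₁ b≤k = at-injective P a≤k b≤k
                                      (trans (≡-sym (concat-≤ a≤k)) (trans eq (concat-≤ b≤k)))
        ... | inj₁ a≤k | inj₂ (i , refl) = ⊥-elim (disjoint a≤k (s≤s z≤n) (+-cancelˡ-≤ k _ _ b≤)
                                      (trans (≡-sym (concat-≤ a≤k)) (trans eq (concat-+ (suc i)))))
        ... | inj₂ (i , refl) | inj₁ b≤k = ⊥-elim (disjoint b≤k (s≤s z≤n) (+-cancelˡ-≤ k _ _ a≤)
                                      (trans (≡-sym (concat-≤ b≤k)) (trans (≡-sym eq) (concat-+ (suc i)))))
        ... | inj₂ (i , refl) | inj₂ (i′ , refl) = cong (k +_) (at-injective Q
                                      (+-cancelˡ-≤ k _ _ a≤) (+-cancelˡ-≤ k _ _ b≤)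
                                      (trans (≡-sym (concat-+ (suc i))) (trans eq (concat-+ (suc i′)))))

        steps : ∀ {a} → a < k + j → concat a ~ concat (suc a)
        steps {a} a< with ≤-or-beyond k (suc a)
        ... | inj₁ 1+a≤k = subst₂ _~_ (≡-sym (concat-≤ (<⇒≤ 1+a≤k))) (≡-sym (concat-≤ 1+a≤k)) (at-step P 1+a≤k)
        ... | inj₂ (i , 1+a≡) = subst₂ _~_ (≡-sym (trans (cong concat a≡) (concat-+ i)))
                                            (≡-sym (trans (cong concat 1+a≡) (concat-+ (suc i))))
                                            (at-step Q (+-cancelˡ-< k _ _ (subst (_< k + j) a≡ a<)))
          where
          a≡ : a ≡ k + i
          a≡ = suc-injective (trans 1+a≡ (+-suc k i))

      join : Path (k + j)
      join = record { at = concat ; at-injective = injective ; at-step = steps }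

  module _ {k} (P : Path k) (2≤k : 2 ≤ k) where

    private
      toℕ≤ : (i : Fin (suc (suc (suc (k ∸ 2))))) → toℕ i ≤ k
      toℕ≤ i = subst (toℕ i ≤_) (m+[n∸m]≡n 2≤k) (≤-pred (toℕ<n i))

    closeUp : at P k ~ at P 0 → Cycle G
    closeUp closing = record
      { len-3 = k ∸ 2
      ; vtx   = λ i → at P (toℕ i)
      ; inj   = λ eq → toℕ-injective (at-injective P (toℕ≤ _) (toℕ≤ _) eq)
      ; step  = λ i → subst (λ b → at P b ~ at P (suc (toℕ i))) (≡-sym (toℕ-inject₁ i))
                        (at-step P (subst (toℕ i <_) (m+[n∸m]≡n 2≤k) (toℕ<n i)))
      ; close = subst (λ b → at P b ~ at P 0) (≡-sym (trans (toℕ-fromℕ _) (m+[n∸m]≡n 2≤k))) closing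
      }

    closeUp-on : ∀ closing {x} → OnCycle (closeUp closing) x → ∃ λ a → a ≤ k × at P a ≡ x
    closeUp-on _ (i , eq) = toℕ i , toℕ≤ i , eq

  module _ {k j} (P : Path k) (Q : Path (suc j))
           (meet : at P k ≡ at Q 0) (return : at Q (suc j) ≡ at P 0)
           (disjoint : ∀ {a i} → a ≤ k → 0 < i → i ≤ j → at P a ≢ at Q i)
           (long : 2 ≤ k + j) where

    open Join P (init Q) meet

    private
      closing : concat (k + j) ~ concat 0
      closing = subst₂ _~_ (≡-sym (concat-+ j)) (trans return (≡-sym (concat-≤ z≤n))) (at-step Q ≤-refl)

    glue : Cycle G
    glue = closeUp (join disjoint) long closing

    glue-on : ∀ {x} → OnCycle glue x → (∃ λ a → a ≤ k × at P a ≡ x) ⊎ (∃ λ i → 0 < i × i ≤ j × at Q i ≡ x)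
    glue-on on with closeUp-on (join disjoint) long closing on
    ... | a , a≤ , refl = concat-on a≤

  record Ear (C : Cycle G) : Set where
    field
      start gap len : ℕ
      gap-pos       : 0 < gap
      gap<size      : gap < size C
      path          : Path (suc len)
      path-start    : at path 0 ≡ around C start
      path-end      : at path (suc len) ≡ around C (start + gap)
      inner-off     : ∀ {i} → 0 < i → i ≤ len → ¬ OnCycle C (at path i)
      new-edge      : ¬ EdgeOf C (at path 0) (at path 1)

  module _ {C : Cycle G} (E : Ear C) where
    open Ear E

    private
      p = start
      q = gap
      o = size C ∸ suc q

      q+1+o≡size : q + suc o ≡ size C
      q+1+o≡size = trans (+-suc q o) (m+[n∸m]≡n gap<size)

      inner-arc : Path q
      inner-arc = arc C p q gap<size

      outer-arc : Path (suc o)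
      outer-arc = arc C (p + q) (suc o) (subst (suc o <_) q+1+o≡size (m<n+m (suc o) gap-pos))

      path-on-C : ∀ {b} → b ≤ suc len → OnCycle C (at path b) → b ≡ 0 ⊎ b ≡ suc len
      path-on-C {zero}  _  _  = inj₁ refl
      path-on-C {suc b} b≤ on with m≤n⇒m<n∨m≡n (≤-pred b≤)
      ... | inj₁ b<len = ⊥-elim (inner-off (s≤s z≤n) b<len on)
      ... | inj₂ refl  = inj₂ refl

      reversed-inner-off : ∀ {i} → 0 < i → i ≤ len → ¬ OnCycle C (at (reverse path) i)
      reversed-inner-off {suc i} _ i<len = inner-off (m<n⇒0<n∸m (s≤s i<len)) (m∸n≤m len i)

      arcs-disjoint : ∀ {a i} → a ≤ q → 0 < i → i ≤ o → at inner-arc a ≢ at outer-arc i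
      arcs-disjoint {a} {i} a≤q 0<i i≤o = around-injective C
        (subst (p + a <_) (≡-sym (+-assoc p q i)) (+-monoʳ-< p (≤-<-trans a≤q (m<m+n q 0<i))))
        (subst₂ _<_ (≡-sym (+-assoc p q i)) (≡-sym (+-assoc p a (size C)))
          (+-monoʳ-< p (<-≤-trans (+-monoʳ-< q (s≤s i≤o))
            (subst (_≤ a + size C) (≡-sym q+1+o≡size) (m≤n+m (size C) a)))))

      -- Both glued cycles have at least three vertices because the first edge of the ear is
      -- not an edge of C.
      long₁ : 2 ≤ q + len
      long₁ with 2 ≤? q + len
      ... | yes long = long
      ... | no short = ⊥-elim (new-edge (subst₂ (EdgeOf C) (≡-sym path-start) next (consecutive⇒edgeOf C p)))
        where
        q≡1   = proj₁ (m+n<2⇒m≡1∧n≡0 gap-pos (≰⇒> short))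
        len≡0 = proj₂ (m+n<2⇒m≡1∧n≡0 gap-pos (≰⇒> short))
        next : around C (suc p) ≡ at path 1
        next = begin
          around C (suc p)   ≡⟨ cong (around C) (+-comm 1 p) ⟩
          around C (p + 1)   ≡⟨ cong (λ t → around C (p + t)) (≡-sym q≡1) ⟩
          around C (p + q)   ≡⟨ ≡-sym path-end ⟩
          at path (suc len)  ≡⟨ cong (at path ∘′ suc) len≡0 ⟩
          at path 1          ∎
          where open ≡-Reasoning

      return₂ : at outer-arc (suc o) ≡ at path 0
      return₂ = begin
        around C (p + q + suc o)  ≡⟨ cong (around C) (trans (+-assoc p q (suc o)) (cong (p +_) q+1+o≡size)) ⟩
        around C (p + size C)     ≡⟨ around-periodic C p ⟩
        around C p                ≡⟨ ≡-sym path-start ⟩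
        at path 0                 ∎
        where open ≡-Reasoning

      long₂ : 2 ≤ suc len + o
      long₂ with 2 ≤? suc len + o
      ... | yes long = long
      ... | no short = ⊥-elim (new-edge (EdgeOf-sym C (subst₂ (EdgeOf C) last next (consecutive⇒edgeOf C (p + q)))))
        where
        1+len≡1 = proj₁ (m+n<2⇒m≡1∧n≡0 (s≤s z≤n) (≰⇒> short))
        o≡0     = proj₂ (m+n<2⇒m≡1∧n≡0 (s≤s z≤n) (≰⇒> short))
        last : around C (p + q) ≡ at path 1
        last = trans (≡-sym path-end) (cong (at path) 1+len≡1)
        next : around C (suc (p + q)) ≡ at path 0
        next = trans (cong (around C) (trans (+-comm 1 (p + q)) (cong (λ t → p + q + suc t) (≡-sym o≡0)))) return₂

      disjoint₁ : ∀ {a i} → a ≤ q → 0 < i → i ≤ len → at inner-arc a ≢ at (reverse path) i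
      disjoint₁ {a} _ 0<i i≤len eq = reversed-inner-off 0<i i≤len (subst (OnCycle C) eq (around-onCycle C (p + a)))

      disjoint₂ : ∀ {a i} → a ≤ suc len → 0 < i → i ≤ o → at path a ≢ at outer-arc i
      disjoint₂ {a} {i} a≤ 0<i i≤o eq with path-on-C a≤ (subst (OnCycle C) (≡-sym eq) (around-onCycle C (p + q + i)))
      ... | inj₁ refl = arcs-disjoint z≤n 0<i i≤o (trans (cong (around C) (+-identityʳ p)) (trans (≡-sym path-start) eq))
      ... | inj₂ refl = arcs-disjoint ≤-refl 0<i i≤o (trans (≡-sym path-end) eq)

      return₁ : at (reverse path) (suc len) ≡ at inner-arc 0
      return₁ = trans (cong (at path) (n∸n≡0 (suc len))) (trans path-start (cong (around C) (≡-sym (+-identityʳ p))))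

      meet₂ : at path (suc len) ≡ at outer-arc 0
      meet₂ = trans path-end (cong (around C) (≡-sym (+-identityʳ (p + q))))

      cycle₁ : Cycle G
      cycle₁ = glue inner-arc (reverse path) (≡-sym path-end) return₁ disjoint₁ long₁

      cycle₂ : Cycle G
      cycle₂ = glue path outer-arc meet₂ return₂ disjoint₂ long₂

      on-C-and-cycle₁ : ∀ {x} → OnCycle C x → OnCycle cycle₁ x → ∃ λ a → a ≤ q × at inner-arc a ≡ x
      on-C-and-cycle₁ x∈C x∈cycle₁ with glue-on inner-arc (reverse path) (≡-sym path-end) return₁ disjoint₁ long₁ x∈cycle₁
      ... | inj₁ on-arc             = on-arc
      ... | inj₂ (i , 0<i , i≤ , e) = ⊥-elim (reversed-inner-off 0<i i≤ (subst (OnCycle C) (≡-sym e) x∈C))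

    ear-ends : ∀ {x} → OnAllCycles x → x ≡ around C start ⊎ x ≡ around C (start + gap)
    ear-ends on-all with on-C-and-cycle₁ (on-all C) (on-all cycle₁)
    ... | a , a≤q , ea with glue-on path outer-arc meet₂ return₂ disjoint₂ long₂ (on-all cycle₂)
    ...   | inj₂ (i , 0<i , i≤o , eb) = ⊥-elim (arcs-disjoint a≤q 0<i i≤o (trans ea (≡-sym eb)))
    ...   | inj₁ (b , b≤ , eb) with path-on-C b≤ (subst (OnCycle C) (≡-sym eb) (on-all C))
    ...     | inj₁ refl = inj₁ (trans (≡-sym eb) path-start)
    ...     | inj₂ refl = inj₂ (trans (≡-sym eb) path-end)

  module _ (C D : Cycle G) where

    private
      meets : ℕ → Set
      meets i = OnCycle C (around D i)

      meets? : ∀ i → Dec (meets i)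
      meets? i = onCycle? C (around D i)

    -- Searching back from a copy of the new edge shifted by a full turn guarantees that the
    -- search range contains a vertex of D on C.
    last-departure : ∀ {u w} → ¬ EdgeOf C u w → EdgeOf D u w → ∀ {x} → OnCycle C x → OnCycle D x →
                     ∃ λ j → meets j × ¬ EdgeOf C (around D j) (around D (suc j))
    last-departure new old x∈C (i , refl) with edgeOf⇒consecutive D old
    ... | a₀ , same
      with greatest meets? (a₀ + size D) (≤-trans (<⇒≤ (toℕ<n i)) (m≤n+m (size D) a₀))
                    (subst (OnCycle C) (≡-sym (around-toℕ D i)) x∈C)
    ... | j , j≤ , meets-j , after with m≤n⇒m<n∨m≡n j≤
    ...   | inj₁ j< = j , meets-j , λ e → after ≤-refl j< (EdgeOf⇒OnCycle C e)
    ...   | inj₂ refl = j , meets-j , λ e → new (EdgeOf-resp C same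
                          (subst₂ (EdgeOf C) (around-periodic D a₀) (around-periodic D (suc a₀)) e))

    first-return : ∀ {x y} → x ≢ y → OnCycle C x → OnCycle D x → OnCycle C y → OnCycle D y → ∀ j →
                   ∃ λ k → suc k < size D × meets (j + suc k) × (∀ {i} → i < k → ¬ meets (j + suc i))
    first-return {x} {y} x≢y x∈C x∈D y∈C y∈D j with returns
      where
      returns : ∃ λ e → suc e < size D × meets (j + suc e)
      returns with onCycle-window D j x∈D | onCycle-window D j y∈D
      ... | suc e , e< , eq | _               = e , e< , subst (OnCycle C) (≡-sym eq) x∈C
      ... | zero , _ , eqx  | suc e , e< , eq = e , e< , subst (OnCycle C) (≡-sym eq) y∈C
      ... | zero , _ , eqx  | zero , _ , eqy  = ⊥-elim (x≢y (trans (≡-sym eqx) eqy))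
    ... | e , e< , meets-e with least (λ i → meets? (j + suc i)) meets-e
    ... | k , k≤e , meets-k , before = k , ≤-<-trans (s≤s k≤e) e< , meets-k , before

    ear : ∀ {u w} → ¬ EdgeOf C u w → EdgeOf D u w →
          ∀ {x y} → x ≢ y → OnCycle C x → OnCycle D x → OnCycle C y → OnCycle D y → Ear C
    ear new old x≢y x∈C x∈D y∈C y∈D with last-departure new old x∈C x∈D
    ... | j , (t , t≡) , departs with first-return x≢y x∈C x∈D y∈C y∈D j
    ... | k , k< , returns , before with onCycle-window C (toℕ t) returns
    ... | zero , _ , eq = ⊥-elim (around-injective D (m<m+n j (s≤s z≤n)) (+-monoʳ-< j k<)
          (trans (≡-sym t≡) (trans (≡-sym (around-toℕ C t)) (trans (cong (around C) (≡-sym (+-identityʳ (toℕ t)))) eq))))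
    ... | suc q , q< , eq = record
      { start      = toℕ t
      ; gap        = suc q
      ; len        = k
      ; gap-pos    = s≤s z≤n
      ; gap<size   = q<
      ; path       = arc D j (suc k) k<
      ; path-start = trans (cong (around D) (+-identityʳ j)) (≡-sym (trans (around-toℕ C t) t≡))
      ; path-end   = ≡-sym eq
      ; inner-off  = λ { {suc i} _ i<k → before i<k }
      ; new-edge   = subst₂ (λ a b → ¬ EdgeOf C (around D a) (around D b))
                       (≡-sym (+-identityʳ j)) (≡-sym (trans (+-suc j 0) (cong suc (+-identityʳ j)))) departs
      }

  NewEdge : Cycle G → Cycle G → Set
  NewEdge C D = ∃ λ u → ∃ λ w → EdgeOf D u w × ¬ EdgeOf C u w

  distinct⇒newEdge : ∀ (C D : Cycle G) → ¬ SameCycle C D → NewEdge C D ⊎ NewEdge D C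
  distinct⇒newEdge C D C≠D with newEdge? C D | newEdge? D C
    where
    newEdge? : ∀ C D → Dec (NewEdge C D)
    newEdge? C D = any? λ u → any? λ w → edgeOf? D u w ×-dec ¬? (edgeOf? C u w)
  ... | yes new | _       = inj₁ new
  ... | no _    | yes new = inj₂ new
  ... | no ¬CD  | no ¬DC  = ⊥-elim (C≠D λ u w → included C D ¬DC u w , included D C ¬CD u w)
    where
    included : ∀ (C D : Cycle G) → ¬ NewEdge D C → ∀ u w → EdgeOf C u w → EdgeOf D u w
    included C D none u w e with edgeOf? D u w
    ... | yes e′ = e′
    ... | no ¬e′ = ⊥-elim (none (u , w , e , ¬e′))

  newEdge⇒at-most-two-on-all-cycles : ∀ (C D : Cycle G) → NewEdge C D → ∀ {x y z} → x ≢ y → x ≢ z → y ≢ z →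
                                      OnAllCycles x → OnAllCycles y → OnAllCycles z → ⊥
  newEdge⇒at-most-two-on-all-cycles C D (u , w , old , new) x≢y x≢z y≢z on-x on-y on-z =
    pair-pigeonhole x≢y x≢z y≢z (ear-ends E on-x) (ear-ends E on-y) (ear-ends E on-z)
    where
    E : Ear C
    E = ear C D new old x≢y (on-x C) (on-x D) (on-y C) (on-y D)

  at-most-two-on-all-cycles : ∀ (C D : Cycle G) → ¬ SameCycle C D → ∀ {x y z} → x ≢ y → x ≢ z → y ≢ z →
                              OnAllCycles x → OnAllCycles y → OnAllCycles z → ⊥
  at-most-two-on-all-cycles C D C≠D with distinct⇒newEdge C D C≠D
  ... | inj₁ new = newEdge⇒at-most-two-on-all-cycles C D new
  ... | inj₂ new = newEdge⇒at-most-two-on-all-cycles D C new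

forest-card⇒onAllCycles : ∀ {n} (X Y : Graph (suc n)) {x y} → IsForest Y → card X x ≅ card Y y →
                          Walks.OnAllCycles X x
forest-card⇒onAllCycles X Y {x} {y} forest iso C with Walks.onCycle? X C x
... | yes on = on
... | no off = ⊥-elim (forest (cycle-from-card Y y (cycle-≅ iso (cycle-in-card X x C λ j e → off (j , e)))))

lemma1 : ∀ {n} (G F : Graph (suc n)) → HasTwoCycles G → IsForest F →
    ∀ m → HasCommonCards m G F → m ≤ 2
lemma1 G F _ _ 0 _ = z≤n
lemma1 G F _ _ 1 _ = s≤s z≤n
lemma1 G F _ _ 2 _ = s≤s (s≤s z≤n)
lemma1 G F (C , D , C≠D) forest (suc (suc (suc _))) (x , _ , x-inj , _ , iso) =
  ⊥-elim (Walks.at-most-two-on-all-cycles G C D C≠D (distinct λ ()) (distinct λ ()) (distinct λ ())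
            (on-all zero) (on-all (suc zero)) (on-all (suc (suc zero))))
  where
  distinct : ∀ {i j} → i ≢ j → x i ≢ x j
  distinct i≢j = i≢j ∘′ x-inj
  on-all : ∀ i → Walks.OnAllCycles G (x i)
  on-all i = forest-card⇒onAllCycles G F forest (iso i)
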